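{- Let $d=2$. A graph $G$ on $n$ vertices has a growth schedule of $n-1$ slots and $0$ excess edges if and only if $G$ has a candidate elimination ordering.
   Context: Growth schedules with edge-activation distance $d$ (a fixed positive integer). A growth schedule of $k$ slots produces graphs $G_0,\dots,G_k$, where $G_0=(\{u_0\},\emptyset)$ is a single vertex. In slot $t$ the process sets $G_t=G_{t-1}$; for every $u\in V(G_{t-1})$ it may add at most one new vertex $u'$ with the edge $uu'$ and any subset of the edges $\{vu' : v\in V(G_{t-1}),\ \mathrm{dist}_{G_{t-1}}(u,v)\le d-1\}$; finally it deletes any set of edges of $G_t$ whose deletion does not disconnect $G_t$. Deleted edges are excess edges; their total number over all slots is the number of excess edges. The schedule grows $G$ if $G_k\cong G$. For a graph $H$ and $v\in V(H)$, $N[v]$ is the closed neighborhood of $v$ in $H$. A vertex $v$ of $H$ is a candidate vertex of $H$ if there is $w\in V(H)\setminus\{v\}$ with $N[v]\subseteq N[w]$ (in $H$). A candidate elimination ordering of $G$ is an ordering $v_1,\dots,v_n$ of $V(G)$ such that for each $1\le i\le n-1$, $v_i$ is a candidate vertex of the subgraph of $G$ induced by $\{v_i,\dots,v_n\}$. -}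

module Defs where

open import Data.Nat using (ℕ; zero; suc; _+_; _∸_; _≤_; _<_; _<ᵇ_)
open import Data.Bool using (Bool; true; false; _∧_; not; if_then_else_)
open import Data.Fin using (Fin; toℕ; _↑ˡ_; _↑ʳ_)
import Data.Fin as F
open import Data.Product using (Σ; ∃; _×_; _,_)
open import Data.Sum using (_⊎_)
open import Relation.Binary.PropositionalEquality using (_≡_; _≢_)
open import Function.Bundles using (_↔_; Inverse)
open import Function.Definitions using (Injective)

record Graph (n : ℕ) : Set where
  field
    adj    : Fin n → Fin n → Bool
    sym    : ∀ i j → adj i j ≡ adj j i
    irrefl : ∀ i → adj i i ≡ false
open Graph public

singleton : Graph 1
singleton = record
  { adj = λ _ _ → false
  ; sym = λ _ _ → _≡_.refl
  ; irrefl = λ _ → _≡_.refl }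

_≅_ : ∀ {a b} → Graph a → Graph b → Set
_≅_ {a} {b} G H = Σ (Fin a ↔ Fin b) λ f →
          ∀ i j → adj H (Inverse.to f i) (Inverse.to f j) ≡ adj G i j

data Reach {n} (G : Graph n) (u : Fin n) : Fin n → Set where
  here : Reach G u u
  step : ∀ {v w} → Reach G u v → adj G v w ≡ true → Reach G u w

Connected : ∀ {n} → Graph n → Set
Connected {n} G = ∀ (u v : Fin n) → Reach G u v

data Within {n} (G : Graph n) : ℕ → Fin n → Fin n → Set where
  here : ∀ {r u} → Within G r u u
  step : ∀ {r u w v} → adj G u w ≡ true → Within G r w v → Within G (suc r) u v

count : ∀ {n} → (Fin n → Bool) → ℕ
count {zero}  f = 0
count {suc n} f = (if f F.zero then 1 else 0) + count (λ i → f (F.suc i))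

sumFin : ∀ {n} → (Fin n → ℕ) → ℕ
sumFin {zero}  f = 0
sumFin {suc n} f = f F.zero + sumFin (λ i → f (F.suc i))

deletedEdges : ∀ {n} → Graph n → Graph n → ℕ
deletedEdges H G' =
  sumFin (λ i → count (λ j → (toℕ i <ᵇ toℕ j) ∧ (adj H i j ∧ not (adj G' i j))))

-- Old graph G on Fin m; k new vertices; new vertex j is (m ↑ʳ j), old vertex
-- u is (u ↑ˡ k).  The parent map p : Fin k → Fin m is injective (each old
-- vertex gets at most one new vertex).  H is G_t after the additions and G'
-- is H after deleting edges (G' must be a connected spanning subgraph of H).

record Slot (d : ℕ) {m : ℕ} (G : Graph m) (k : ℕ)
            (H G' : Graph (m + k)) : Set where
  field
    p      : Fin k → Fin m
    p-inj  : Injective _≡_ _≡_ p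
    old-old : ∀ u v → adj H (u ↑ˡ k) (v ↑ˡ k) ≡ adj G u v
    new-new : ∀ i j → adj H (m ↑ʳ i) (m ↑ʳ j) ≡ false
    parent  : ∀ j → adj H (p j ↑ˡ k) (m ↑ʳ j) ≡ true
    local   : ∀ v j → adj H (v ↑ˡ k) (m ↑ʳ j) ≡ true → Within G (d ∸ 1) (p j) v
    subgraph  : ∀ x y → adj G' x y ≡ true → adj H x y ≡ true
    connected : Connected G'

-- Schedule d t G e : a growth schedule with distance d of t slots whose final
-- graph G_t is G (on the vertex set Fin n) and which has e excess edges.
data Schedule (d : ℕ) : ℕ → ∀ {n} → Graph n → ℕ → Set where
  start : Schedule d 0 singleton 0
  slot  : ∀ {t m e k} {G : Graph m} {H G' : Graph (m + k)} →
          Schedule d t G e → Slot d G k H G' →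
          Schedule d (suc t) G' (e + deletedEdges H G')

HasSchedule : ∀ {n} → ℕ → ℕ → ℕ → Graph n → Set
HasSchedule d t e G = Σ ℕ λ n' → Σ (Graph n') λ G' → Schedule d t G' e × (G' ≅ G)

ClosedNbr : ∀ {n} → Graph n → Fin n → Fin n → Set
ClosedNbr G v x = (x ≡ v) ⊎ (adj G v x ≡ true)

CandidateIn : ∀ {n} → Graph n → (Fin n → Set) → Fin n → Set
CandidateIn {n} G S v =
  S v × Σ (Fin n) λ w → S w × (w ≢ v) ×
    (∀ x → S x → ClosedNbr G v x → ClosedNbr G w x)

-- A candidate elimination ordering: a bijection σ : Fin n ↔ Fin n with
-- v_i = σ i, such that for each i with i+1 < n, v_i is a candidate vertex of
-- G[{v_i, …, v_n}].
CandidateEliminationOrdering : ∀ {n} → Graph n → Set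
CandidateEliminationOrdering {n} G =
  Σ (Fin n ↔ Fin n) λ σ →
    ∀ (i : Fin n) → suc (toℕ i) < n →
      CandidateIn G (λ x → toℕ i ≤ toℕ (Inverse.from σ x)) (Inverse.to σ i)

-- With d = 2 and no excess edges nothing is ever deleted, and a vertex created in a
-- slot is adjacent to its parent and otherwise only to neighbours of its parent
-- (never to vertices created in the same slot).  Numbering the vertices by creation
-- time, every vertex but the first thus has an earlier neighbour adjacent to all its
-- other earlier neighbours.  Read backwards this is a candidate elimination ordering:
-- that neighbour w witnesses N[v] ⊆ N[w] among the vertices not yet eliminated.
-- Conversely, following a reversed candidate elimination ordering, one slot attaches
-- each vertex to such a dominating neighbour.
module Submission where

open import Defs hiding (sym)
open import Data.Nat using (ℕ; zero; suc; _+_; _∸_; _≤_; _<_; _<ᵇ_; z≤n; s≤s)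
open import Data.Nat.Properties
  using ( <-cmp; <-irrefl; <-asym; <⇒≤; ≤-refl; ≤-trans; <-≤-trans
        ; ≤∧≢⇒<; m≤n⇒m<n∨m≡n; m≤m+n; n≤1+n; <⇒<ᵇ; <⇒≱; m∸n≡0⇒m≤n
        ; ∸-monoʳ-≤; m+n≡0⇒m≡0; m+n≡0⇒n≡0; +-comm; +-identityʳ )
open import Data.Bool using (Bool; true; false; _∧_; if_then_else_)
open import Data.Bool.Properties using (T-≡; not-injective; ∧-inverseʳ; ∧-zeroʳ)
open import Data.Fin using (Fin; toℕ; opposite; inject≤; cast; fromℕ<; _↑ˡ_; _↑ʳ_)
import Data.Fin as F
open import Data.Fin.Properties
  using ( toℕ-injective; toℕ<n; toℕ-↑ˡ; toℕ-↑ʳ; toℕ-inject≤; toℕ-cast; toℕ-fromℕ<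
        ; opposite-prop; opposite-involutive; opposite-suc )
open import Data.Fin.Permutation using (reverse; ↔⇒≡)
open import Data.Product using (∃; _,_; proj₁; proj₂)
open import Data.Sum using (inj₁; inj₂)
open import Data.Empty using (⊥-elim)
open import Function using (_∘_)
open import Function.Bundles using (_↔_; _⇔_; Inverse; Equivalence; mk↔ₛ′; mk⇔)
open import Function.Construct.Composition using (_↔-∘_)
open import Function.Construct.Symmetry using (↔-sym)
open import Relation.Binary.Definitions using (tri<; tri≈; tri>)
open import Relation.Binary.PropositionalEquality
  using (_≡_; _≢_; refl; sym; trans; cong; cong₂; subst; subst₂; module ≡-Reasoning)
open import Relation.Nullary using (contradiction)

open Inverse using (to; from; strictlyInverseˡ; strictlyInverseʳ)

count≡0⇒false : ∀ {n} (f : Fin n → Bool) → count f ≡ 0 → ∀ j → f j ≡ false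
count≡0⇒false {suc n} f eq F.zero with f F.zero | eq
... | false | _ = refl
count≡0⇒false {suc n} f eq (F.suc j) =
  count≡0⇒false (f ∘ F.suc) (m+n≡0⇒n≡0 (if f F.zero then 1 else 0) eq) j

count-false : ∀ {n} (f : Fin n → Bool) → (∀ j → f j ≡ false) → count f ≡ 0
count-false {zero}  f _ = refl
count-false {suc n} f h rewrite h F.zero = count-false (f ∘ F.suc) (h ∘ F.suc)

sumFin≡0⇒≡0 : ∀ {n} (f : Fin n → ℕ) → sumFin f ≡ 0 → ∀ j → f j ≡ 0
sumFin≡0⇒≡0 {suc n} f eq F.zero    = m+n≡0⇒m≡0 (f F.zero) eq
sumFin≡0⇒≡0 {suc n} f eq (F.suc j) = sumFin≡0⇒≡0 (f ∘ F.suc) (m+n≡0⇒n≡0 (f F.zero) eq) j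

sumFin-zero : ∀ {n} (f : Fin n → ℕ) → (∀ j → f j ≡ 0) → sumFin f ≡ 0
sumFin-zero {zero}  f _ = refl
sumFin-zero {suc n} f h rewrite h F.zero = sumFin-zero (f ∘ F.suc) (h ∘ F.suc)

deletedEdges-refl : ∀ {n} (H : Graph n) → deletedEdges H H ≡ 0
deletedEdges-refl H = sumFin-zero _ λ i → count-false _ λ j →
  trans (cong ((toℕ i <ᵇ toℕ j) ∧_) (∧-inverseʳ (adj H i j))) (∧-zeroʳ _)

deletedEdges≡0⇒⊆-< : ∀ {n} (H G : Graph n) → deletedEdges H G ≡ 0 →
                     ∀ {x y} → toℕ x < toℕ y → adj H x y ≡ true → adj G x y ≡ true
deletedEdges≡0⇒⊆-< H G none {x} {y} x<y xy
  with entry ← count≡0⇒false _ (sumFin≡0⇒≡0 _ none x) y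
  rewrite Equivalence.to T-≡ (<⇒<ᵇ x<y) | xy = not-injective entry

deletedEdges≡0⇒⊆ : ∀ {n} (H G : Graph n) → deletedEdges H G ≡ 0 →
                   ∀ x y → adj H x y ≡ true → adj G x y ≡ true
deletedEdges≡0⇒⊆ H G none x y xy with <-cmp (toℕ x) (toℕ y)
... | tri< x<y _ _ = deletedEdges≡0⇒⊆-< H G none x<y xy
... | tri≈ _ x≡y _ with refl ← toℕ-injective x≡y =
  contradiction (trans (sym xy) (irrefl H x)) λ ()
... | tri> _ _ y<x =
  trans (Graph.sym G x y) (deletedEdges≡0⇒⊆-< H G none y<x (trans (Graph.sym H y x) xy))

true⇔true⇒≡ : ∀ {a b} → (a ≡ true → b ≡ true) → (b ≡ true → a ≡ true) → a ≡ b
true⇔true⇒≡ {false} {false} _ _ = refl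
true⇔true⇒≡ {false} {true}  _ b⇒a = b⇒a refl
true⇔true⇒≡ {true}          a⇒b _ = sym (a⇒b refl)

pullback : ∀ {m n} → (Fin m → Fin n) → Graph n → Graph m
pullback f G = record
  { adj    = λ i j → adj G (f i) (f j)
  ; sym    = λ i j → Graph.sym G (f i) (f j)
  ; irrefl = λ i → irrefl G (f i) }

pullback-≅ : ∀ {m n} (f : Fin m ↔ Fin n) (G : Graph n) → pullback (to f) G ≅ G
pullback-≅ f G = f , λ _ _ → refl

≅-sym : ∀ {a b} {G : Graph a} {H : Graph b} → G ≅ H → H ≅ G
≅-sym {G = G} {H} (f , f-adj) = ↔-sym f , λ i j → begin
  adj G (from f i) (from f j)               ≡⟨ f-adj (from f i) (from f j) ⟨
  adj H (to f (from f i)) (to f (from f j)) ≡⟨ cong₂ (adj H) (strictlyInverseˡ f i) (strictlyInverseˡ f j) ⟩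
  adj H i j                                 ∎
  where open ≡-Reasoning

≅-trans : ∀ {a b c} {G : Graph a} {H : Graph b} {K : Graph c} → G ≅ H → H ≅ K → G ≅ K
≅-trans (f , f-adj) (g , g-adj) = g ↔-∘ f , λ i j → trans (g-adj (to f i) (to f j)) (f-adj i j)

Reach-trans : ∀ {n} {G : Graph n} {u v w} → Reach G u v → Reach G v w → Reach G u w
Reach-trans r here         = r
Reach-trans r (step r′ vw) = step (Reach-trans r r′) vw

Reach-sym : ∀ {n} {G : Graph n} {u v} → Reach G u v → Reach G v u
Reach-sym here                = here
Reach-sym {G = G} (step r vw) = Reach-trans (step here (trans (Graph.sym G _ _) vw)) (Reach-sym r)

Reach-map : ∀ {m n} {G : Graph m} {H : Graph n} (f : Fin m → Fin n) →
            (∀ u v → adj G u v ≡ true → adj H (f u) (f v) ≡ true) →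
            ∀ {u v} → Reach G u v → Reach H (f u) (f v)
Reach-map f f-adj here        = here
Reach-map f f-adj (step r vw) = step (Reach-map f f-adj r) (f-adj _ _ vw)

Connected-via : ∀ {n} {G : Graph n} (c : Fin n) → (∀ u → Reach G u c) → Connected G
Connected-via c to-c u v = Reach-trans (to-c u) (Reach-sym (to-c v))

Schedule-connected : ∀ {d t n e} {G : Graph n} → Schedule d t G e → Connected G
Schedule-connected start F.zero F.zero = here
Schedule-connected (slot _ S)         = Slot.connected S

data Split (m k : ℕ) : Fin (m + k) → Set where
  old : (u : Fin m) → Split m k (u ↑ˡ k)
  new : (j : Fin k) → Split m k (m ↑ʳ j)

split : ∀ m k (a : Fin (m + k)) → Split m k a
split zero    k a         = new a
split (suc m) k F.zero    = old F.zero
split (suc m) k (F.suc a) with split m k a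
... | old u = old (F.suc u)
... | new j = new j

toℕ-↑ˡ<↑ʳ : ∀ {m k} (u : Fin m) (j : Fin k) → toℕ (u ↑ˡ k) < toℕ (m ↑ʳ j)
toℕ-↑ˡ<↑ʳ {m} {k} u j rewrite toℕ-↑ˡ u k | toℕ-↑ʳ m j = <-≤-trans (toℕ<n u) (m≤m+n m (toℕ j))

-- Growth orderings

record IsParent {n} (G : Graph n) (v w : Fin n) : Set where
  field
    earlier   : toℕ w < toℕ v
    adjacent  : adj G v w ≡ true
    dominates : ∀ x → toℕ x < toℕ v → adj G v x ≡ true → ClosedNbr G w x

GrowthOrdered : ∀ {n} → Graph n → Set
GrowthOrdered {n} G = ∀ (v : Fin n) → toℕ v ≢ 0 → ∃ (IsParent G v)

GrowthOrdered-cong : ∀ {n} {G H : Graph n} → (∀ x y → adj G x y ≡ adj H x y) →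
                     GrowthOrdered G → GrowthOrdered H
GrowthOrdered-cong {G = G} {H} G≡H ordered v v≢0 =
  proj₁ (ordered v v≢0) , parent-cong (proj₂ (ordered v v≢0))
  where
  closedNbr-cong : ∀ {w x} → ClosedNbr G w x → ClosedNbr H w x
  closedNbr-cong (inj₁ x≡w) = inj₁ x≡w
  closedNbr-cong (inj₂ wx)  = inj₂ (trans (sym (G≡H _ _)) wx)
  parent-cong : ∀ {w} → IsParent G v w → IsParent H v w
  parent-cong {w} parent = record
    { earlier   = earlier
    ; adjacent  = trans (sym (G≡H v w)) adjacent
    ; dominates = λ x x<v vx → closedNbr-cong (dominates x x<v (trans (G≡H v x) vx)) }
    where open IsParent parent

module _ {m k} {G : Graph m} {H G′ : Graph (m + k)} (S : Slot 2 G k H G′) where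
  open Slot S

  old-parent : ∀ {u w} → IsParent G u w → IsParent H (u ↑ˡ k) (w ↑ˡ k)
  old-parent {u} {w} parent = record
    { earlier   = subst₂ _<_ (sym (toℕ-↑ˡ w k)) (sym (toℕ-↑ˡ u k)) earlier
    ; adjacent  = trans (old-old u w) adjacent
    ; dominates = λ x → dominates′ x (split m k x) }
    where
    open IsParent parent
    dominates′ : ∀ x → Split m k x → toℕ x < toℕ (u ↑ˡ k) →
                 adj H (u ↑ˡ k) x ≡ true → ClosedNbr H (w ↑ˡ k) x
    dominates′ _ (old y) y<u uy
      with dominates y (subst₂ _<_ (toℕ-↑ˡ y k) (toℕ-↑ˡ u k) y<u) (trans (sym (old-old u y)) uy)
    ... | inj₁ refl = inj₁ refl
    ... | inj₂ wy   = inj₂ (trans (old-old w y) wy)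
    dominates′ _ (new j) j<u _ = ⊥-elim (<-asym j<u (toℕ-↑ˡ<↑ʳ u j))

  new-parent : ∀ j → IsParent H (m ↑ʳ j) (p j ↑ˡ k)
  new-parent j = record
    { earlier   = toℕ-↑ˡ<↑ʳ (p j) j
    ; adjacent  = trans (Graph.sym H _ _) (parent j)
    ; dominates = λ x → dominates′ x (split m k x) }
    where
    dominates′ : ∀ x → Split m k x → toℕ x < toℕ (m ↑ʳ j) →
                 adj H (m ↑ʳ j) x ≡ true → ClosedNbr H (p j ↑ˡ k) x
    dominates′ _ (old y) _ jy with local y j (trans (Graph.sym H _ _) jy)
    ... | here         = inj₁ refl
    ... | step py here = inj₂ (trans (old-old (p j) y) py)
    dominates′ _ (new i) _ ji = contradiction (trans (sym ji) (new-new j i)) λ ()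

  Slot-growthOrdered : GrowthOrdered G → GrowthOrdered H
  Slot-growthOrdered ordered v v≢0 with split m k v
  ... | new j = p j ↑ˡ k , new-parent j
  ... | old u = let w , parent = ordered u (v≢0 ∘ trans (toℕ-↑ˡ u k)) in
                w ↑ˡ k , old-parent parent

zeroExcess⇒growthOrdered : ∀ {t n e} {G : Graph n} → Schedule 2 t G e → e ≡ 0 → GrowthOrdered G
zeroExcess⇒growthOrdered start _ F.zero 0≢0 = contradiction refl 0≢0
zeroExcess⇒growthOrdered (slot {e = e} {H = H} {G′} sch S) none =
  GrowthOrdered-cong (λ x y → true⇔true⇒≡ (kept x y) (Slot.subgraph S x y))
    (Slot-growthOrdered S (zeroExcess⇒growthOrdered sch (m+n≡0⇒m≡0 e none)))
  where
  kept : ∀ x y → adj H x y ≡ true → adj G′ x y ≡ true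
  kept = deletedEdges≡0⇒⊆ H G′ (m+n≡0⇒n≡0 e none)

Below : ∀ {n} → Fin n → Fin n → Set
Below v x = toℕ x ≤ toℕ v

CandidateIn-resp : ∀ {n} {G : Graph n} {S T : Fin n → Set} {v} →
                   (∀ x → S x → T x) → (∀ x → T x → S x) →
                   CandidateIn G S v → CandidateIn G T v
CandidateIn-resp S⇒T T⇒S (Sv , w , Sw , w≢v , closed) =
  S⇒T _ Sv , w , S⇒T w Sw , w≢v , λ x Tx → closed x (T⇒S x Tx)

CandidateIn-≅ : ∀ {a b} {X : Graph a} {G : Graph b} (iso : X ≅ G) {S : Fin b → Set} {v} →
                CandidateIn G S (to (proj₁ iso) v) → CandidateIn X (S ∘ to (proj₁ iso)) v
CandidateIn-≅ {X = X} {G} (f , f-adj) {S} {v} (Sv , w , Sw , w≢v , closed) =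
  Sv , from f w , subst S (sym (strictlyInverseˡ f w)) Sw , from-w≢v , closed′
  where
  from-w≢v : from f w ≢ v
  from-w≢v w≡v = w≢v (trans (sym (strictlyInverseˡ f w)) (cong (to f) w≡v))
  push : ∀ {u x} → ClosedNbr X u x → ClosedNbr G (to f u) (to f x)
  push (inj₁ x≡u) = inj₁ (cong (to f) x≡u)
  push (inj₂ ux)  = inj₂ (trans (f-adj _ _) ux)
  pull : ∀ {x} → ClosedNbr G w (to f x) → ClosedNbr X (from f w) x
  pull {x} (inj₁ x≡w) = inj₁ (trans (sym (strictlyInverseʳ f x)) (cong (from f) x≡w))
  pull {x} (inj₂ wx)  = inj₂ (trans (sym (f-adj (from f w) x))
                                    (trans (cong (λ y → adj G y (to f x)) (strictlyInverseˡ f w)) wx))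
  closed′ : ∀ x → S (to f x) → ClosedNbr X v x → ClosedNbr X (from f w) x
  closed′ x Sx vx = pull (closed (to f x) Sx (push vx))

parent⇒candidate : ∀ {n} {G : Graph n} {v w} → IsParent G v w → CandidateIn G (Below v) v
parent⇒candidate {G = G} {v} {w} parent =
  ≤-refl , w , <⇒≤ earlier , w≢v , closed
  where
  open IsParent parent
  w≢v : w ≢ v
  w≢v refl = <-irrefl refl earlier
  wv : adj G w v ≡ true
  wv = trans (Graph.sym G w v) adjacent
  closed : ∀ x → Below v x → ClosedNbr G v x → ClosedNbr G w x
  closed x _ (inj₁ refl) = inj₂ wv
  closed x x≤v (inj₂ vx) with m≤n⇒m<n∨m≡n x≤v
  ... | inj₁ x<v = dominates x x<v vx
  ... | inj₂ x≡v with refl ← toℕ-injective x≡v = inj₂ wv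

candidate⇒parent : ∀ {n} {G : Graph n} {v} → CandidateIn G (Below v) v → ∃ (IsParent G v)
candidate⇒parent {G = G} {v} (_ , w , w≤v , w≢v , closed) = w , record
  { earlier   = ≤∧≢⇒< w≤v (w≢v ∘ toℕ-injective)
  ; adjacent  = adjacent (closed v ≤-refl (inj₁ refl))
  ; dominates = λ x x<v vx → closed x (<⇒≤ x<v) (inj₂ vx) }
  where
  adjacent : ClosedNbr G w v → adj G v w ≡ true
  adjacent (inj₁ v≡w) = contradiction (sym v≡w) w≢v
  adjacent (inj₂ wv)  = trans (Graph.sym G v w) wv

-- Candidate elimination orderings are reversed growth orderings

≤-opposite : ∀ {n} {x y : Fin n} → toℕ x ≤ toℕ y → toℕ (opposite y) ≤ toℕ (opposite x)
≤-opposite {n} {x} {y} x≤y rewrite opposite-prop x | opposite-prop y = ∸-monoʳ-≤ n (s≤s x≤y)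

≤-opposite-swap : ∀ {n} {i x : Fin n} → toℕ i ≤ toℕ (opposite x) → toℕ x ≤ toℕ (opposite i)
≤-opposite-swap {i = i} {x} i≤x′ =
  subst (λ z → toℕ z ≤ toℕ (opposite i)) (opposite-involutive x) (≤-opposite i≤x′)

opposite-≢0 : ∀ {n} (i : Fin n) → suc (toℕ i) < n → toℕ (opposite i) ≢ 0
opposite-≢0 {n} i i<n i′≡0 = <⇒≱ i<n (m∸n≡0⇒m≤n (trans (sym (opposite-prop i)) i′≡0))

suc-opposite-suc< : ∀ {n} (i : Fin n) → suc (toℕ (opposite (F.suc i))) < suc n
suc-opposite-suc< i rewrite opposite-suc i = s≤s (toℕ<n (opposite i))

growthOrdered⇒ceo : ∀ {n} {G : Graph n} → GrowthOrdered G → CandidateEliminationOrdering G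
growthOrdered⇒ceo {G = G} ordered = reverse , λ i i<n →
  let _ , parent = ordered (opposite i) (opposite-≢0 i i<n) in
  CandidateIn-resp {G = G} (λ x → ≤-opposite-swap {i = x} {i}) (λ x → ≤-opposite-swap {i = i} {x})
    (parent⇒candidate {G = G} parent)

ceo⇒growthOrdered : ∀ {n} {G : Graph n} ((σ , _) : CandidateEliminationOrdering G) →
                    GrowthOrdered (pullback (to σ ∘ opposite) G)
ceo⇒growthOrdered (σ , _) F.zero 0≢0 = contradiction refl 0≢0
ceo⇒growthOrdered {G = G} (σ , candidate) (F.suc v) _ =
  candidate⇒parent (CandidateIn-resp {G = Y} below⇒ ⇒below candidate′)
  where
  Y = pullback (to σ ∘ opposite) G
  i = opposite (F.suc v)
  candidate′ : CandidateIn Y (λ x → toℕ i ≤ toℕ (from σ (to σ (opposite x)))) (F.suc v)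
  candidate′ = CandidateIn-≅ {X = Y} {G} (pullback-≅ (σ ↔-∘ reverse) G)
                 (candidate i (suc-opposite-suc< v))
  below⇒ : ∀ x → toℕ i ≤ toℕ (from σ (to σ (opposite x))) → Below (F.suc v) x
  below⇒ x i≤x′ = subst (λ z → toℕ x ≤ toℕ z) (opposite-involutive (F.suc v))
    (≤-opposite-swap (subst (λ z → toℕ i ≤ toℕ z) (strictlyInverseʳ σ (opposite x)) i≤x′))
  ⇒below : ∀ x → Below (F.suc v) x → toℕ i ≤ toℕ (from σ (to σ (opposite x)))
  ⇒below x x≤v = subst (λ z → toℕ i ≤ toℕ z) (sym (strictlyInverseʳ σ (opposite x))) (≤-opposite x≤v)

ceo-≅ : ∀ {a b} {X : Graph a} {G : Graph b} → X ≅ G →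
        CandidateEliminationOrdering X → CandidateEliminationOrdering G
ceo-≅ {X = X} {G} (f , f-adj) (σ , candidate) with refl ← ↔⇒≡ f =
  f ↔-∘ σ , λ i i<n →
    let Later = λ x → toℕ i ≤ toℕ (from σ x) in
    CandidateIn-≅ {X = G} {X} (≅-sym {G = X} {G} (f , f-adj)) {S = Later}
      (subst (CandidateIn X Later) (sym (strictlyInverseʳ f (to σ i))) (candidate i i<n))

-- Growing a growth-ordered graph

HasSchedule-≅ : ∀ {d t e a b} {X : Graph a} {G : Graph b} → HasSchedule d t e X → X ≅ G →
                HasSchedule d t e G
HasSchedule-≅ {X = X} {G} (_ , Z , sch , Z≅X) X≅G = _ , Z , sch , ≅-trans {G = Z} {X} {G} Z≅X X≅G

module _ {n₀} (Y : Graph (suc n₀)) (ordered : GrowthOrdered Y) where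

  -- The subgraph of Y induced by its first m + 1 vertices, grown in m slots.
  record Stage (m : ℕ) : Set where
    field
      {size}   : ℕ
      graph    : Graph size
      schedule : Schedule 2 m graph 0
      size≡    : size ≡ suc m
      size≤    : size ≤ suc n₀
      agrees   : ∀ u v → adj graph u v ≡ adj Y (inject≤ u size≤) (inject≤ v size≤)

  stage-zero : Stage 0
  stage-zero = record
    { graph    = singleton
    ; schedule = start
    ; size≡    = refl
    ; size≤    = s≤s z≤n
    ; agrees   = λ { F.zero F.zero → sym (irrefl Y F.zero) } }

  stage-suc : ∀ {m} → Stage m → suc m ≤ n₀ → Stage (suc m)
  stage-suc {m} st sm≤n₀ = record
    { graph    = H
    ; schedule = subst (Schedule 2 (suc m) H) (deletedEdges-refl H) (slot schedule grow)
    ; size≡    = size′≡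
    ; size≤    = size′≤
    ; agrees   = λ _ _ → refl }
    where
    open Stage st
    size′≡ : size + 1 ≡ suc (suc m)
    size′≡ = trans (+-comm size 1) (cong suc size≡)
    size′≤ : size + 1 ≤ suc n₀
    size′≤ = subst (_≤ suc n₀) (sym size′≡) (s≤s sm≤n₀)

    embed : Fin size → Fin (suc n₀)
    embed u = inject≤ u size≤
    embed-injective : ∀ {u v} → embed u ≡ embed v → u ≡ v
    embed-injective {u} {v} e =
      toℕ-injective (trans (sym (toℕ-inject≤ u size≤)) (trans (cong toℕ e) (toℕ-inject≤ v size≤)))
    embed′ : Fin (size + 1) → Fin (suc n₀)
    embed′ a = inject≤ a size′≤
    embed′-old : ∀ u → embed′ (u ↑ˡ 1) ≡ embed u
    embed′-old u = toℕ-injective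
      (trans (toℕ-inject≤ _ size′≤) (trans (toℕ-↑ˡ u 1) (sym (toℕ-inject≤ u size≤))))

    H = pullback embed′ Y
    c = embed′ (size ↑ʳ F.zero)
    toℕ-c : toℕ c ≡ size
    toℕ-c = trans (toℕ-inject≤ _ size′≤) (trans (toℕ-↑ʳ size F.zero) (+-identityʳ size))
    c≢0 : toℕ c ≢ 0
    c≢0 c≡0 = contradiction (trans (sym (trans toℕ-c size≡)) c≡0) λ ()

    w = proj₁ (ordered c c≢0)
    open IsParent (proj₂ (ordered c c≢0))
    w<size : toℕ w < size
    w<size = subst (toℕ w <_) toℕ-c earlier
    p : Fin size
    p = fromℕ< w<size
    embed-p : embed p ≡ w
    embed-p = toℕ-injective (trans (toℕ-inject≤ p size≤) (toℕ-fromℕ< w<size))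

    old-old : ∀ u v → adj H (u ↑ˡ 1) (v ↑ˡ 1) ≡ adj graph u v
    old-old u v = trans (cong₂ (adj Y) (embed′-old u) (embed′-old v)) (sym (agrees u v))
    parent-edge : adj H (p ↑ˡ 1) (size ↑ʳ F.zero) ≡ true
    parent-edge = trans (cong (λ z → adj Y z c) (trans (embed′-old p) embed-p))
                        (trans (Graph.sym Y w c) adjacent)

    local : ∀ v j → adj H (v ↑ˡ 1) (size ↑ʳ j) ≡ true → Within graph 1 p v
    local v F.zero vc with dominates (embed v) embed-v<c cv
      where
      embed-v<c : toℕ (embed v) < toℕ c
      embed-v<c = subst₂ _<_ (sym (toℕ-inject≤ v size≤)) (sym toℕ-c) (toℕ<n v)
      cv : adj Y c (embed v) ≡ true
      cv = trans (Graph.sym Y c (embed v)) (trans (cong (λ z → adj Y z c) (sym (embed′-old v))) vc)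
    ... | inj₁ v≡w with refl ← embed-injective (trans v≡w (sym embed-p)) = here
    ... | inj₂ wv = step (trans (agrees p v) (trans (cong (λ z → adj Y z (embed v)) embed-p) wv)) here

    to-p : ∀ a → Reach H a (p ↑ˡ 1)
    to-p a with split size 1 a
    ... | old u      = Reach-map (_↑ˡ 1) (λ u v uv → trans (old-old u v) uv)
                                 (Schedule-connected schedule u p)
    ... | new F.zero = step here (trans (Graph.sym H _ _) parent-edge)

    grow : Slot 2 graph 1 H H
    grow = record
      { p         = λ _ → p
      ; p-inj     = λ { {F.zero} {F.zero} _ → refl }
      ; old-old   = old-old
      ; new-new   = λ { F.zero F.zero → irrefl Y c }
      ; parent    = λ { F.zero → parent-edge }
      ; local     = local
      ; subgraph  = λ _ _ e → e
      ; connected = Connected-via (p ↑ˡ 1) to-p }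

  stage : ∀ m → m ≤ n₀ → Stage m
  stage zero    _     = stage-zero
  stage (suc m) sm≤n₀ = stage-suc (stage m (≤-trans (n≤1+n m) sm≤n₀)) sm≤n₀

  growthOrdered⇒schedule : HasSchedule 2 n₀ 0 Y
  growthOrdered⇒schedule = size , graph , schedule , embedding , λ i j → sym (agrees i j)
    where
    open Stage (stage n₀ ≤-refl)
    embedding : Fin size ↔ Fin (suc n₀)
    embedding = mk↔ₛ′ (λ u → inject≤ u size≤) (cast (sym size≡))
      (λ y → toℕ-injective (trans (toℕ-inject≤ _ size≤) (toℕ-cast _ y)))
      (λ u → toℕ-injective (trans (toℕ-cast _ _) (toℕ-inject≤ u size≤)))

mainTheorem3 : ∀ (n : ℕ) → 1 ≤ n → (G : Graph n) →
    HasSchedule 2 (n ∸ 1) 0 G ⇔ CandidateEliminationOrdering G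
mainTheorem3 (suc n₀) _ G = mk⇔ grown⇒ceo ceo⇒grown
  where
  grown⇒ceo : HasSchedule 2 n₀ 0 G → CandidateEliminationOrdering G
  grown⇒ceo (_ , X , sch , X≅G) =
    ceo-≅ {X = X} {G} X≅G (growthOrdered⇒ceo (zeroExcess⇒growthOrdered sch refl))

  ceo⇒grown : CandidateEliminationOrdering G → HasSchedule 2 n₀ 0 G
  ceo⇒grown ceo@(σ , _) =
    HasSchedule-≅ {X = Y} {G} (growthOrdered⇒schedule Y (ceo⇒growthOrdered {G = G} ceo))
      (pullback-≅ (σ ↔-∘ reverse) G)
    where
    Y = pullback (to σ ∘ opposite) G
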